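{- For $n\ge2$, let $\sim$ be the equivalence relation on $B_n$ relating $t$ and $t'$ if and only if, for every $p\in\{x_1,\dots,x_n\}$, $p$ has depth $1$ in $G(t)$ exactly when $p$ has depth $1$ in $G(t')$. Then $|B_n/{\sim}|=2^{n-2}$.
   Context: $B_n$ is the set of bracketings of $x_1x_2\cdots x_n$ (binary terms with $x_1,\dots,x_n$ each occurring once, in this order). For $t\in B_n$, $G(t)$ is the rooted tree on $\{x_1,\dots,x_n\}$ defined recursively: $G(x_i)$ is the single vertex $x_i$; for $t=t_1t_2$, $G(t)$ is $G(t_1)\cup G(t_2)$ plus an edge from the root of $G(t_1)$ to the root of $G(t_2)$, rooted at the root of $G(t_1)$. Depth is the distance from the root $x_1$. -}

module Defs where

open import Data.Nat using (ℕ; zero; suc; _+_)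
open import Data.Fin using (Fin; zero; _↑ˡ_; _↑ʳ_)
open import Data.List using (List; []; _∷_; _++_; map)
open import Data.List.Membership.Propositional using (_∈_)
open import Data.Product using (_×_; _,_)
open import Function.Bundles using (_⇔_)

-- Bracketings of x_1 ... x_n : binary trees with n leaves; the leaves are,
-- from left to right, x_1, ..., x_n (identified with Fin n: x_{i+1} ↔ i).
data B : ℕ → Set where
  x    : B 1
  _·_  : ∀ {m k} → B m → B k → B (m + k)

-- A rooted graph on vertex set Fin n: a root and a list of directed edges
-- (parent , child).
record RootedGraph (n : ℕ) : Set where
  constructor rg
  field
    root  : Fin n
    edges : List (Fin n × Fin n)
open RootedGraph public

private
  mapPair : ∀ {a b} → (Fin a → Fin b) → Fin a × Fin a → Fin b × Fin b
  mapPair f (u , v) = f u , f v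

G : ∀ {n} → B n → RootedGraph n
G x = rg zero []
G (_·_ {m} {k} t₁ t₂) =
  rg (root (G t₁) ↑ˡ k)
     (map (mapPair (_↑ˡ k)) (edges (G t₁))
       ++ map (mapPair (m ↑ʳ_)) (edges (G t₂))
       ++ ((root (G t₁) ↑ˡ k , m ↑ʳ root (G t₂)) ∷ []))

data HasDepth {n : ℕ} (g : RootedGraph n) : Fin n → ℕ → Set where
  depth-root : HasDepth g (root g) 0
  depth-step : ∀ {u v d} → (u , v) ∈ edges g → HasDepth g u d → HasDepth g v (suc d)

_∼_ : ∀ {n} → B n → B n → Set
_∼_ {n} t t' = (p : Fin n) → HasDepth (G t) p 1 ⇔ HasDepth (G t') p 1

-- A vertex lies at depth 1 in G(t) exactly when it is the leftmost leaf of
-- one of the right factors hanging off the left spine of t.  So the depth-1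
-- set is recorded by a boolean vector which always starts with false, true
-- (x₁ is the root, x₂ its first child), and conversely every vector with that
-- prefix is realised by a left spine whose right factors have the prescribed
-- sizes.  The classes of ∼ are therefore the 2^(n-2) vectors of length n - 2.
module Submission where

open import Defs
open import Level using (Level)
open import Data.Nat using (ℕ; zero; suc; _+_; _^_; _∸_; _≤_; z≤n; s≤s)
open import Data.Nat.Properties using (suc-injective; m+n≡0⇒n≡0)
open import Data.Fin using (Fin; zero; suc; toℕ; _↑ˡ_; _↑ʳ_; splitAt)
open import Data.Fin.Properties
  using (toℕ-↑ˡ; toℕ-↑ʳ; toℕ-injective; ↑ˡ-injective; ↑ʳ-injective;
         splitAt-↑ˡ; splitAt-↑ʳ; splitAt⁻¹-↑ˡ; splitAt⁻¹-↑ʳ; *↔×; 2↔Bool)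
open import Data.Bool using (Bool; true; false)
open import Data.Bool.Properties using (⇔→≡)
open import Data.Vec using (Vec; []; _∷_; _++_; lookup; replicate; tabulate; drop; uncons)
open import Data.Vec.Properties
  using (lookup-++ˡ; lookup-++ʳ; lookup-replicate; tabulate∘lookup; tabulate-cong)
open import Data.List using (map)
open import Data.List.Membership.Propositional using (_∈_)
open import Data.List.Membership.Propositional.Properties using (∈-map⁺; ∈-map⁻; ∈-++⁺ˡ; ∈-++⁺ʳ; ∈-++⁻)
open import Data.List.Relation.Unary.Any using (here)
open import Data.Product using (Σ; ∃; _×_; _,_; uncurry)
open import Data.Product.Properties using (,-injectiveˡ; ,-injectiveʳ)
open import Data.Product.Function.NonDependent.Propositional using (_×-↔_)
open import Data.Sum using (inj₁; inj₂)
open import Data.Empty using (⊥-elim)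
open import Function using (_∘_)
open import Function.Bundles using (_⇔_; _↔_; mk⇔; mk↔ₛ′; Inverse; Equivalence)
open import Function.Construct.Composition using (_⇔-∘_; _↔-∘_)
open import Function.Construct.Symmetry using (⇔-sym; ↔-sym)
open import Function.Related.Propositional using (module EquationalReasoning; equivalence)
open import Relation.Binary.PropositionalEquality
  using (_≡_; _≢_; _≗_; refl; sym; trans; cong; subst; module ≡-Reasoning)
open import Relation.Nullary using (contradiction)

private variable
  a : Level
  A : Set a
  m k n : ℕ

lookup-injective : {xs ys : Vec A n} → lookup xs ≗ lookup ys → xs ≡ ys
lookup-injective {xs = xs} {ys} eq = begin
  xs                   ≡⟨ tabulate∘lookup xs ⟨
  tabulate (lookup xs) ≡⟨ tabulate-cong eq ⟩
  tabulate (lookup ys) ≡⟨ tabulate∘lookup ys ⟩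
  ys                   ∎
  where open ≡-Reasoning

Vec-suc↔× : Vec A (suc n) ↔ (A × Vec A n)
Vec-suc↔× = mk↔ₛ′ uncons (uncurry _∷_) (λ _ → refl) λ { (_ ∷ _) → refl }

Vec↔^ : A ↔ Fin m → ∀ n → Vec A n ↔ Fin (m ^ n)
Vec↔^ A↔Fin zero    = mk↔ₛ′ (λ _ → zero) (λ _ → []) (λ { zero → refl }) λ { [] → refl }
Vec↔^ A↔Fin (suc n) = ↔-sym *↔× ↔-∘ ((A↔Fin ×-↔ Vec↔^ A↔Fin n) ↔-∘ Vec-suc↔×)

↑ˡ≢↑ʳ : (i : Fin m) (j : Fin k) → i ↑ˡ k ≢ m ↑ʳ j
↑ˡ≢↑ʳ {m} {k} i j eq
  with () ← trans (sym (splitAt-↑ˡ m i k)) (trans (cong (splitAt m) eq) (splitAt-↑ʳ m k j))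

data SplitView (m k : ℕ) : Fin (m + k) → Set where
  left  : (i : Fin m) → SplitView m k (i ↑ˡ k)
  right : (j : Fin k) → SplitView m k (m ↑ʳ j)

splitView : ∀ m k (p : Fin (m + k)) → SplitView m k p
splitView m k p with splitAt m p in eq
... | inj₁ i = subst (SplitView m k) (splitAt⁻¹-↑ˡ eq) (left i)
... | inj₂ j = subst (SplitView m k) (splitAt⁻¹-↑ʳ eq) (right j)

onlyFirst : ∀ k → Vec Bool k
onlyFirst zero    = []
onlyFirst (suc k) = true ∷ replicate k false

-- The i-th entry records whether x_(i+1) has depth 1 in G(t): the new edge of
-- G(t₁ t₂) joins the root to the leftmost leaf of t₂, and nothing else changes.
depth1 : B n → Vec Bool n
depth1 x         = false ∷ []
depth1 (t₁ · t₂) = depth1 t₁ ++ onlyFirst _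

lookup-onlyFirst : (j : Fin k) → lookup (onlyFirst k) j ≡ true ⇔ toℕ j ≡ 0
lookup-onlyFirst zero    = mk⇔ (λ _ → refl) (λ _ → refl)
lookup-onlyFirst (suc j) = mk⇔ (λ e → contradiction (trans (sym (lookup-replicate j false)) e) λ ()) λ ()

size-suc : B n → ∃ λ n′ → n ≡ suc n′
size-suc x = 0 , refl
size-suc (t₁ · t₂) with _ , refl ← size-suc t₁ = _ , refl

toℕ-root : (t : B n) → toℕ (root (G t)) ≡ 0
toℕ-root x                   = refl
toℕ-root (_·_ {k = k} t₁ t₂) = trans (toℕ-↑ˡ (root (G t₁)) k) (toℕ-root t₁)

≡root⇔toℕ≡0 : (t : B n) (j : Fin n) → j ≡ root (G t) ⇔ toℕ j ≡ 0
≡root⇔toℕ≡0 t j = mk⇔ (λ e → trans (cong toℕ e) (toℕ-root t))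
                       (λ e → toℕ-injective (trans e (sym (toℕ-root t))))

depth1-first : (t : B n) (p : Fin n) → toℕ p ≡ 0 → lookup (depth1 t) p ≡ false
depth1-first x zero _ = refl
depth1-first (_·_ {m} {k} t₁ t₂) p p≡0 with splitView m k p
... | left i = trans (lookup-++ˡ (depth1 t₁) _ i) (depth1-first t₁ i (trans (sym (toℕ-↑ˡ i k)) p≡0))
... | right j with _ , refl ← size-suc t₁ = contradiction (trans (sym (toℕ-↑ʳ m j)) p≡0) λ ()

depth1-second : (t : B n) (p : Fin n) → toℕ p ≡ 1 → lookup (depth1 t) p ≡ true
depth1-second x zero ()
depth1-second (_·_ {m} {k} t₁ t₂) p p≡1 with splitView m k p
... | left i = trans (lookup-++ˡ (depth1 t₁) _ i) (depth1-second t₁ i (trans (sym (toℕ-↑ˡ i k)) p≡1))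
... | right j with m′ , refl ← size-suc t₁ =
  trans (lookup-++ʳ (depth1 t₁) _ j)
        (Equivalence.from (lookup-onlyFirst j) (m+n≡0⇒n≡0 m′ (suc-injective (trans (sym (toℕ-↑ʳ m j)) p≡1))))

depth1-prefix : (t : B (2 + n)) → depth1 t ≡ false ∷ true ∷ drop 2 (depth1 t)
depth1-prefix t with depth1 t | depth1-first t zero refl | depth1-second t (suc zero) refl
... | _ ∷ _ ∷ _ | refl | refl = refl

hasDepth1⇔rootEdge : (g : RootedGraph n) (p : Fin n) → HasDepth g p 1 ⇔ (root g , p) ∈ edges g
hasDepth1⇔rootEdge g p = mk⇔ (λ { (depth-step e depth-root) → e }) (λ e → depth-step e depth-root)

module _ (t₁ : B m) (t₂ : B k) where

  left-edge⇔ : ∀ u i → (u ↑ˡ k , i ↑ˡ k) ∈ edges (G (t₁ · t₂)) ⇔ (u , i) ∈ edges (G t₁)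
  left-edge⇔ u i = mk⇔ to (∈-++⁺ˡ ∘ ∈-map⁺ _)
    where
    to : (u ↑ˡ k , i ↑ˡ k) ∈ edges (G (t₁ · t₂)) → (u , i) ∈ edges (G t₁)
    to e with ∈-++⁻ (map _ (edges (G t₁))) e
    ... | inj₁ e₁
      with (a , b) , ab , eq ← ∈-map⁻ _ e₁
      with refl ← ↑ˡ-injective k u a (,-injectiveˡ eq)
         | refl ← ↑ˡ-injective k i b (,-injectiveʳ eq) = ab
    ... | inj₂ e₂ with ∈-++⁻ (map _ (edges (G t₂))) e₂
    ...   | inj₁ e₃ with (a , _) , _ , eq ← ∈-map⁻ _ e₃ = ⊥-elim (↑ˡ≢↑ʳ u a (,-injectiveˡ eq))
    ...   | inj₂ (here eq) = ⊥-elim (↑ˡ≢↑ʳ i (root (G t₂)) (,-injectiveʳ eq))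

  rootEdge-↑ʳ⇔ : ∀ j → (root (G t₁) ↑ˡ k , m ↑ʳ j) ∈ edges (G (t₁ · t₂)) ⇔ j ≡ root (G t₂)
  rootEdge-↑ʳ⇔ j = mk⇔ to λ { refl →
    ∈-++⁺ʳ (map _ (edges (G t₁))) (∈-++⁺ʳ (map _ (edges (G t₂))) (here refl)) }
    where
    to : (root (G t₁) ↑ˡ k , m ↑ʳ j) ∈ edges (G (t₁ · t₂)) → j ≡ root (G t₂)
    to e with ∈-++⁻ (map _ (edges (G t₁))) e
    ... | inj₁ e₁ with (_ , b) , _ , eq ← ∈-map⁻ _ e₁ = ⊥-elim (↑ˡ≢↑ʳ b j (sym (,-injectiveʳ eq)))
    ... | inj₂ e₂ with ∈-++⁻ (map _ (edges (G t₂))) e₂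
    ...   | inj₁ e₃ with (a , _) , _ , eq ← ∈-map⁻ _ e₃ = ⊥-elim (↑ˡ≢↑ʳ _ a (,-injectiveˡ eq))
    ...   | inj₂ (here eq) = ↑ʳ-injective m j _ (,-injectiveʳ eq)

rootEdge⇔depth1 : (t : B n) (p : Fin n) → (root (G t) , p) ∈ edges (G t) ⇔ lookup (depth1 t) p ≡ true
rootEdge⇔depth1 x zero = mk⇔ (λ ()) (λ ())
rootEdge⇔depth1 (_·_ {m} {k} t₁ t₂) p with splitView m k p
... | left i = begin
  (root (G t₁) ↑ˡ k , i ↑ˡ k) ∈ edges (G (t₁ · t₂)) ∼⟨ left-edge⇔ t₁ t₂ _ i ⟩
  (root (G t₁) , i) ∈ edges (G t₁)                   ∼⟨ rootEdge⇔depth1 t₁ i ⟩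
  lookup (depth1 t₁) i ≡ true                        ≡⟨ cong (_≡ true) (lookup-++ˡ (depth1 t₁) _ i) ⟨
  lookup (depth1 (t₁ · t₂)) (i ↑ˡ k) ≡ true          ∎
  where open EquationalReasoning {k = equivalence}
... | right j = begin
  (root (G t₁) ↑ˡ k , m ↑ʳ j) ∈ edges (G (t₁ · t₂)) ∼⟨ rootEdge-↑ʳ⇔ t₁ t₂ j ⟩
  j ≡ root (G t₂)                                    ∼⟨ ≡root⇔toℕ≡0 t₂ j ⟩
  toℕ j ≡ 0                                          ∼⟨ ⇔-sym (lookup-onlyFirst j) ⟩
  lookup (onlyFirst k) j ≡ true                      ≡⟨ cong (_≡ true) (lookup-++ʳ (depth1 t₁) _ j) ⟨
  lookup (depth1 (t₁ · t₂)) (m ↑ʳ j) ≡ true          ∎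
  where open EquationalReasoning {k = equivalence}

depth1-correct : (t : B n) (p : Fin n) → HasDepth (G t) p 1 ⇔ lookup (depth1 t) p ≡ true
depth1-correct t p = rootEdge⇔depth1 t p ⇔-∘ hasDepth1⇔rootEdge (G t) p

∼⇔depth1≡ : (t t′ : B n) → t ∼ t′ ⇔ depth1 t ≡ depth1 t′
∼⇔depth1≡ t t′ = mk⇔ to from
  where
  to : t ∼ t′ → depth1 t ≡ depth1 t′
  to t∼t′ = lookup-injective λ p →
    ⇔→≡ ((depth1-correct t′ p ⇔-∘ t∼t′ p) ⇔-∘ ⇔-sym (depth1-correct t p))
  from : depth1 t ≡ depth1 t′ → t ∼ t′
  from eq p = ⇔-sym (depth1-correct t′ p) ⇔-∘
              subst (λ v → HasDepth (G t) p 1 ⇔ lookup v p ≡ true) eq (depth1-correct t p)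

data Blocks : Vec Bool n → Set where
  zeros    : Blocks (replicate n false)
  _+block_ : {v : Vec Bool n} → Blocks v → ∀ k → Blocks (v ++ onlyFirst (suc k))

cons-blocks : ∀ b {v : Vec Bool n} → Blocks v → Blocks (b ∷ v)
cons-blocks false zeros        = zeros
cons-blocks true  (zeros {n})  = zeros {0} +block n
cons-blocks b     (bs +block k) = cons-blocks b bs +block k

blocks : (v : Vec Bool n) → Blocks v
blocks []      = zeros
blocks (b ∷ v) = cons-blocks b (blocks v)

comb : ∀ n → B (suc n)
comb zero    = x
comb (suc n) = x · comb n

realise : {w : Vec Bool n} → Blocks w → Σ (B (2 + n)) λ t → depth1 t ≡ false ∷ true ∷ w
realise (zeros {n})   = x · comb n , refl
realise (bs +block k) with t , eq ← realise bs = t · comb k , cong (_++ onlyFirst (suc k)) eq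

lemma8p5 : (n : ℕ) → 2 ≤ n →
    Σ (B n → Fin (2 ^ (n ∸ 2))) λ f →
      ((y : Fin (2 ^ (n ∸ 2))) → ∃ λ t → f t ≡ y)
      × ((t t' : B n) → (f t ≡ f t') ⇔ (t ∼ t'))
lemma8p5 _ (s≤s (s≤s (z≤n {n}))) = code , code-surjective , code-fibres
  where
  open Inverse (Vec↔^ (↔-sym 2↔Bool) n)

  code : B (2 + n) → Fin (2 ^ n)
  code t = to (drop 2 (depth1 t))

  code-surjective : ∀ y → ∃ λ t → code t ≡ y
  code-surjective y with t , eq ← realise (blocks (from y)) =
    t , trans (cong (to ∘ drop 2) eq) (strictlyInverseˡ y)

  code-injective : ∀ t t′ → code t ≡ code t′ → depth1 t ≡ depth1 t′
  code-injective t t′ eq = begin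
    depth1 t                              ≡⟨ depth1-prefix t ⟩
    false ∷ true ∷ drop 2 (depth1 t)      ≡⟨ cong (λ w → false ∷ true ∷ w) drops≡ ⟩
    false ∷ true ∷ drop 2 (depth1 t′)     ≡⟨ depth1-prefix t′ ⟨
    depth1 t′                             ∎
    where
    open ≡-Reasoning
    drops≡ : drop 2 (depth1 t) ≡ drop 2 (depth1 t′)
    drops≡ = trans (sym (strictlyInverseʳ _)) (trans (cong from eq) (strictlyInverseʳ _))

  code-fibres : ∀ t t′ → code t ≡ code t′ ⇔ t ∼ t′
  code-fibres t t′ = ⇔-sym (∼⇔depth1≡ t t′) ⇔-∘ mk⇔ (code-injective t t′) (cong (to ∘ drop 2))
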